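{- Let $n \geq 3$ and $2 \leq i \leq n-1$. For every signed permutation $\pi \in \mathfrak{B}_n$, one of $\pi$ and $\mathrm{Sgn\_flip}_i(\pi)$ has exactly one more alternating run than the other, i.e. $|\mathrm{altruns}_B(\mathrm{Sgn\_flip}_i(\pi)) - \mathrm{altruns}_B(\pi)| = 1$.
   Context: $\mathfrak{B}_n$ is the set of signed permutations of $[n]$, written as words $\pi = \pi_1,\ldots,\pi_n$ with $\pi_i \in \{\pm 1,\ldots,\pm n\}$ and $|\pi_1|,\ldots,|\pi_n|$ a permutation of $[n]$; $\overline{a}$ denotes $-a$. Set $\pi_0 = 0$. For $1 \leq i \leq n-1$, $\pi$ changes direction at $i$ if $\pi_{i-1} < \pi_i > \pi_{i+1}$ or $\pi_{i-1} > \pi_i < \pi_{i+1}$ (usual order on integers). $\mathrm{altruns}_B(\pi)$ is $1$ plus the number of indices at which $\pi$ changes direction. For $1 \leq k \leq n$, $\mathrm{Sgn\_flip}_k(\pi) = \pi_1,\ldots,\pi_{k-1},\overline{\pi_k},\ldots,\overline{\pi_n}$ (flip the sign of every entry from position $k$ onwards). -}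

module Defs where

open import Data.Nat using (ℕ; zero; suc; _≤_; _∸_; _+_)
open import Data.Integer using (ℤ; +_; -_; ∣_∣; _<_; _>_; _<?_)
open import Data.List using (List; []; _∷_; length; map; take; drop; _++_)
open import Data.List.Relation.Unary.All using (All)
open import Data.List.Relation.Unary.Unique.Propositional using (Unique)
open import Data.Product using (_×_)
open import Relation.Nullary.Decidable using (⌊_⌋)
open import Data.Bool using (Bool; true; false; _∧_; _∨_; if_then_else_)
open import Relation.Binary.PropositionalEquality using (_≡_)

IsSignedPerm : ℕ → List ℤ → Set
IsSignedPerm n π =
  (length π ≡ n) × All (λ x → 1 ≤ ∣ x ∣ × ∣ x ∣ ≤ n) π × Unique (map ∣_∣ π)

changesDir : ℤ → ℤ → ℤ → Bool
changesDir a b c = (⌊ a <? b ⌋ ∧ ⌊ c <? b ⌋) ∨ (⌊ b <? a ⌋ ∧ ⌊ b <? c ⌋)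

countChanges : List ℤ → ℕ
countChanges (a ∷ b ∷ c ∷ rest) =
  (if changesDir a b c then 1 else 0) + countChanges (b ∷ c ∷ rest)
countChanges _ = zero

-- altruns_B(π) = 1 + #{ i ∈ [1, n-1] : π changes direction at i }, with π₀ = 0.
-- The triples (π_{i-1}, π_i, π_{i+1}) for 1 ≤ i ≤ n-1 are exactly the
-- consecutive triples of the word 0, π₁, …, πₙ.
altrunsB : List ℤ → ℕ
altrunsB π = suc (countChanges (+ 0 ∷ π))

-- Sgn_flip_k(π) = π₁ … π_{k-1}, -π_k, …, -π_n   (k is 1-indexed)
sgnFlip : ℕ → List ℤ → List ℤ
sgnFlip k π = take (k ∸ 1) π ++ map -_ (drop (k ∸ 1) π)

-- Flipping the signs from position i on only touches the direction changes at i − 1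
-- and i: everything before is unchanged, and everything after is negated, which
-- swaps peaks and valleys. Since consecutive entries of 0, π₁, …, πₙ differ in
-- absolute value, the comparisons are strict, so a direction change is the xor of
-- two consecutive "ascent" bits. With p, q, r the ascent bits at i − 2, i − 1, i,
-- the two affected changes contribute (p ⊕ q) + (q ⊕ r) ∈ {0, 1, 2}, of parity
-- p ⊕ r; after the flip r becomes ¬ r and q changes arbitrarily, so the parity
-- changes and the contribution moves by exactly one.
module Submission where

open import Defs
open import Data.Bool using (Bool; true; false; not; _∧_; _∨_; _xor_; if_then_else_)
open import Data.Bool.Properties using (∨-comm; ∨-identityʳ)
open import Data.Empty using (⊥-elim)
open import Data.Integer using (ℤ; +_; -_; _-_; _⊖_; ∣_∣; _<?_)
import Data.Integer.Properties as ℤ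
open import Data.List using (List; []; _∷_; length; map; take; drop; _++_)
open import Data.List.Relation.Unary.All as All using (All)
import Data.List.Relation.Unary.All.Properties as All
open import Data.List.Relation.Unary.AllPairs using (_∷_)
open import Data.List.Relation.Unary.Linked using (Linked; _∷_)
import Data.List.Relation.Unary.Linked.Properties as Linked
open import Data.Nat using (ℕ; zero; suc; _+_; _∸_; _≤_; s≤s; z≤n)
open import Data.Nat.Properties using (n≤1+n; m+n∸n≡m; <⇒≢)
open import Data.Product using (_,_; proj₁)
open import Data.Sum as Sum using (_⊎_; inj₁; inj₂)
open import Function using (_on_; _∘_)
open import Relation.Binary.PropositionalEquality
  using (_≡_; _≢_; refl; sym; trans; cong; cong₂; subst; module ≡-Reasoning)
open import Relation.Nullary using (yes; no)
open import Relation.Nullary.Decidable using (⌊_⌋)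

open ≡-Reasoning

Adjacent : ℕ → ℕ → Set
Adjacent m n = m ≡ suc n ⊎ n ≡ suc m

+ˡ-Adjacent : ∀ k {m n} → Adjacent m n → Adjacent (k + m) (k + n)
+ˡ-Adjacent zero    adj = adj
+ˡ-Adjacent (suc k) adj = Sum.map (cong suc) (cong suc) (+ˡ-Adjacent k adj)

∣[+1+n]-[+n]∣≡1 : ∀ n → ∣ + suc n - + n ∣ ≡ 1
∣[+1+n]-[+n]∣≡1 n = begin
  ∣ + suc n - + n ∣   ≡⟨ cong ∣_∣ (ℤ.[+m]-[+n]≡m⊖n (suc n) n) ⟩
  ∣ suc n ⊖ n ∣       ≡⟨ cong ∣_∣ (ℤ.⊖-≥ (n≤1+n n)) ⟩
  suc n ∸ n           ≡⟨ m+n∸n≡m 1 n ⟩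
  1                   ∎

Adjacent⇒∣-∣≡1 : ∀ {m n} → Adjacent m n → ∣ + m - + n ∣ ≡ 1
Adjacent⇒∣-∣≡1 {n = n} (inj₁ refl) = ∣[+1+n]-[+n]∣≡1 n
Adjacent⇒∣-∣≡1 {m = m} (inj₂ refl) = begin
  ∣ + m - + suc m ∣   ≡⟨ ℤ.∣i-j∣≡∣j-i∣ (+ m) (+ suc m) ⟩
  ∣ + suc m - + m ∣   ≡⟨ ∣[+1+n]-[+n]∣≡1 m ⟩
  1                   ∎

𝟙 : Bool → ℕ
𝟙 b = if b then 1 else 0

-- (p ⊕ q) + (q ⊕ r) has parity p ⊕ r and lies in {0, 1, 2}.
xor-pair-negate-Adjacent : ∀ p q q′ r t →
  Adjacent (𝟙 (p xor q′) + (𝟙 (q′ xor not r) + t)) (𝟙 (p xor q) + (𝟙 (q xor r) + t))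
xor-pair-negate-Adjacent true  true  true  true  t = inj₁ refl
xor-pair-negate-Adjacent true  true  true  false t = inj₂ refl
xor-pair-negate-Adjacent true  true  false true  t = inj₁ refl
xor-pair-negate-Adjacent true  true  false false t = inj₁ refl
xor-pair-negate-Adjacent true  false true  true  t = inj₂ refl
xor-pair-negate-Adjacent true  false true  false t = inj₂ refl
xor-pair-negate-Adjacent true  false false true  t = inj₂ refl
xor-pair-negate-Adjacent true  false false false t = inj₁ refl
xor-pair-negate-Adjacent false true  true  true  t = inj₁ refl
xor-pair-negate-Adjacent false true  true  false t = inj₂ refl
xor-pair-negate-Adjacent false true  false true  t = inj₂ refl
xor-pair-negate-Adjacent false true  false false t = inj₂ refl
xor-pair-negate-Adjacent false false true  true  t = inj₁ refl
xor-pair-negate-Adjacent false false true  false t = inj₁ refl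
xor-pair-negate-Adjacent false false false true  t = inj₂ refl
xor-pair-negate-Adjacent false false false false t = inj₁ refl

infix 7 _<ᵇ_

_<ᵇ_ : ℤ → ℤ → Bool
x <ᵇ y = ⌊ x <? y ⌋

<ᵇ-flip : ∀ {x y} → x ≢ y → y <ᵇ x ≡ not (x <ᵇ y)
<ᵇ-flip {x} {y} x≢y with x <? y | y <? x
... | yes x<y | yes y<x = ⊥-elim (ℤ.<-asym x<y y<x)
... | yes _   | no  _   = refl
... | no  _   | yes _   = refl
... | no  x≮y | no  y≮x = ⊥-elim (x≮y (ℤ.≤∧≢⇒< (ℤ.≮⇒≥ y≮x) x≢y))

neg-<ᵇ : ∀ x y → - x <ᵇ - y ≡ y <ᵇ x
neg-<ᵇ x y with - x <? - y | y <? x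
... | yes _     | yes _   = refl
... | yes -x<-y | no  y≮x = ⊥-elim (y≮x (ℤ.neg-cancel-< -x<-y))
... | no  -x≮-y | yes y<x = ⊥-elim (-x≮-y (ℤ.neg-mono-< y<x))
... | no  _     | no  _   = refl

xor-as-∨ : ∀ p q → (p ∧ not q) ∨ (not p ∧ q) ≡ p xor q
xor-as-∨ true  q = ∨-identityʳ (not q)
xor-as-∨ false q = refl

changesDir-xor : ∀ {x y z} → x ≢ y → y ≢ z → changesDir x y z ≡ (x <ᵇ y) xor (y <ᵇ z)
changesDir-xor {x} {y} {z} x≢y y≢z = begin
  (x <ᵇ y ∧ z <ᵇ y) ∨ (y <ᵇ x ∧ y <ᵇ z)
    ≡⟨ cong₂ (λ u v → (x <ᵇ y ∧ u) ∨ (v ∧ y <ᵇ z)) (<ᵇ-flip y≢z) (<ᵇ-flip x≢y) ⟩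
  (x <ᵇ y ∧ not (y <ᵇ z)) ∨ (not (x <ᵇ y) ∧ y <ᵇ z)
    ≡⟨ xor-as-∨ (x <ᵇ y) (y <ᵇ z) ⟩
  (x <ᵇ y) xor (y <ᵇ z)
    ∎

changesDir-neg : ∀ a b c → changesDir (- a) (- b) (- c) ≡ changesDir a b c
changesDir-neg a b c = begin
  (- a <ᵇ - b ∧ - c <ᵇ - b) ∨ (- b <ᵇ - a ∧ - b <ᵇ - c)
    ≡⟨ cong₂ _∨_ (cong₂ _∧_ (neg-<ᵇ a b) (neg-<ᵇ c b))
                 (cong₂ _∧_ (neg-<ᵇ b a) (neg-<ᵇ b c)) ⟩
  (b <ᵇ a ∧ b <ᵇ c) ∨ (a <ᵇ b ∧ c <ᵇ b)
    ≡⟨ ∨-comm (b <ᵇ a ∧ b <ᵇ c) (a <ᵇ b ∧ c <ᵇ b) ⟩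
  (a <ᵇ b ∧ c <ᵇ b) ∨ (b <ᵇ a ∧ b <ᵇ c)
    ∎

countChanges-map-neg : ∀ xs → countChanges (map -_ xs) ≡ countChanges xs
countChanges-map-neg (a ∷ b ∷ c ∷ xs) =
  cong₂ (λ u v → 𝟙 u + v) (changesDir-neg a b c) (countChanges-map-neg (b ∷ c ∷ xs))
countChanges-map-neg []           = refl
countChanges-map-neg (_ ∷ [])     = refl
countChanges-map-neg (_ ∷ _ ∷ []) = refl

∣∣-≢⇒≢ : ∀ {x y} → ∣ x ∣ ≢ ∣ y ∣ → x ≢ y
∣∣-≢⇒≢ ∣x∣≢∣y∣ refl = ∣x∣≢∣y∣ refl

∣∣-≢⇒≢-neg : ∀ {x y} → ∣ x ∣ ≢ ∣ y ∣ → x ≢ - y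
∣∣-≢⇒≢-neg {y = y} ∣x∣≢∣y∣ refl = ∣x∣≢∣y∣ (ℤ.∣-i∣≡∣i∣ y)

flipFrom : ℕ → List ℤ → List ℤ
flipFrom k w = take k w ++ map -_ (drop k w)

countChanges-flipFrom : ∀ k (w : List ℤ) → 2 ≤ k → 2 + k ≤ length w →
  Linked (_≢_ on ∣_∣) w → Adjacent (countChanges (flipFrom k w)) (countChanges w)
countChanges-flipFrom 2 (a ∷ b ∷ c ∷ d ∷ w) _ _ (ab ∷ bc ∷ cd ∷ _)
  rewrite changesDir-xor {a} {b} { - c} (∣∣-≢⇒≢ ab) (∣∣-≢⇒≢-neg bc)
        | changesDir-xor {b} { - c} { - d} (∣∣-≢⇒≢-neg bc) (∣∣-≢⇒≢ cd ∘ ℤ.neg-injective)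
        | trans (neg-<ᵇ c d) (<ᵇ-flip (∣∣-≢⇒≢ cd))
        | changesDir-xor {a} {b} {c} (∣∣-≢⇒≢ ab) (∣∣-≢⇒≢ bc)
        | changesDir-xor {b} {c} {d} (∣∣-≢⇒≢ bc) (∣∣-≢⇒≢ cd)
        | countChanges-map-neg (c ∷ d ∷ w)
  = xor-pair-negate-Adjacent (a <ᵇ b) (b <ᵇ c) (b <ᵇ - c) (c <ᵇ d) (countChanges (c ∷ d ∷ w))
countChanges-flipFrom (suc (suc (suc k))) (a ∷ b ∷ c ∷ w) _ (s≤s len) (_ ∷ linked) =
  +ˡ-Adjacent (𝟙 (changesDir a b c))
    (countChanges-flipFrom (suc (suc k)) (b ∷ c ∷ w) (s≤s (s≤s z≤n)) len linked)
countChanges-flipFrom 0 _ () _ _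
countChanges-flipFrom 1 _ (s≤s ()) _ _
countChanges-flipFrom (suc (suc _)) (_ ∷ []) _ (s≤s ()) _
countChanges-flipFrom 2 (_ ∷ _ ∷ []) _ (s≤s (s≤s ())) _
countChanges-flipFrom 2 (_ ∷ _ ∷ _ ∷ []) _ (s≤s (s≤s (s≤s ()))) _
countChanges-flipFrom (suc (suc (suc _))) (_ ∷ _ ∷ []) _ (s≤s (s≤s ())) _

lemma7 : (n i : ℕ) → 3 ≤ n → 2 ≤ i → i ≤ n ∸ 1 →
    (π : List ℤ) → IsSignedPerm n π →
    ∣ + altrunsB (sgnFlip i π) - + altrunsB π ∣ ≡ 1
-- Since i ≥ 1, altrunsB (sgnFlip i π) is definitionally 1 + countChanges (flipFrom i (+ 0 ∷ π)).
lemma7 (suc n) i@(suc _) _ 2≤i i≤n π (length≡ , bounds , unique) =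
  Adjacent⇒∣-∣≡1 (+ˡ-Adjacent 1
    (countChanges-flipFrom i (+ 0 ∷ π) 2≤i 2+i≤length consecutive-∣∣-distinct))
  where
  2+i≤length : 2 + i ≤ length (+ 0 ∷ π)
  2+i≤length = subst (2 + i ≤_) (cong suc (sym length≡)) (s≤s (s≤s i≤n))

  0∉∣π∣ : All (0 ≢_) (map ∣_∣ π)
  0∉∣π∣ = All.map⁺ (All.map (<⇒≢ ∘ proj₁) bounds)

  consecutive-∣∣-distinct : Linked (_≢_ on ∣_∣) (+ 0 ∷ π)
  consecutive-∣∣-distinct = Linked.map⁻ (Linked.AllPairs⇒Linked (0∉∣π∣ ∷ unique))
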